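{- Let $\hat A$ be a change action whose base set has a distinguished element $\bot$, let $U\subseteq(A\to A)$ carry a functional change action $\hat U=(U,\Delta U,\oplus_U,+_U,0_U)$ with derivative $\partial\mathrm{Ev}$ of the evaluation map, and let $\mathrm{iter}|_U:U\times\mathbb N\to A$, $\mathrm{iter}|_U(f,n)=f^n(\bot)$. Define $\partial_1\mathrm{iter}|_U(f,0,\delta f)=0_A$ and, for $n\ge1$, $\partial_1\mathrm{iter}|_U(f,n,\delta f)=\partial\mathrm{Ev}\big((f,\mathrm{iter}|_U(f,n-1)),(\delta f,\partial_1\mathrm{iter}|_U(f,n-1,\delta f))\big)$. Then $\mathrm{iter}|_U$ is differentiable in its first argument with partial derivative $\partial_1\mathrm{iter}|_U$: for all $f\in U$, $\delta f\in\Delta U$, $n\in\mathbb N$, $\mathrm{iter}|_U(f\oplus_U\delta f,n)=\mathrm{iter}|_U(f,n)\oplus_A\partial_1\mathrm{iter}|_U(f,n,\delta f)$.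
   Context: A change action $\hat A=(A,\Delta A,\oplus,+,0)$ is a set $A$, a monoid $(\Delta A,+,0)$ and a monoid action $\oplus:A\times\Delta A\to A$ ($a\oplus 0=a$, $a\oplus(\delta_1+\delta_2)=(a\oplus\delta_1)\oplus\delta_2$). Given $U\subseteq A\to A$, a change action $\hat U$ on $U$ is functional if the evaluation map $\mathrm{Ev}(f,a)=f(a)$ is differentiable with respect to the product change action on $U\times A$ (changes $\Delta U\times\Delta A$, componentwise), i.e. there is $\partial\mathrm{Ev}$ with $(f\oplus_U\delta f)(a\oplus_A\delta a)=f(a)\oplus_A\partial\mathrm{Ev}((f,a),(\delta f,\delta a))$ for all $f,a,\delta f,\delta a$. -}

module Defs where

open import Level using (Level; _⊔_) renaming (suc to lsuc)
open import Data.Nat using (ℕ; zero; suc)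
open import Data.Product using (Σ; _,_; proj₁; _×_)
open import Relation.Binary.PropositionalEquality using (_≡_)

record ChangeAction {a d : Level} (A : Set a) : Set (a ⊔ lsuc d) where
  field
    Δ      : Set d
    _⊕_    : A → Δ → A
    _+Δ_   : Δ → Δ → Δ
    0Δ     : Δ
    +-identityˡ : ∀ x → 0Δ +Δ x ≡ x
    +-identityʳ : ∀ x → x +Δ 0Δ ≡ x
    +-assoc     : ∀ x y z → (x +Δ y) +Δ z ≡ x +Δ (y +Δ z)
    ⊕-0 : ∀ a → a ⊕ 0Δ ≡ a
    ⊕-+ : ∀ a δ₁ δ₂ → a ⊕ (δ₁ +Δ δ₂) ≡ (a ⊕ δ₁) ⊕ δ₂

open ChangeAction public

Sub : ∀ {a p : Level} (A : Set a) → (P : (A → A) → Set p) → Set (a ⊔ p)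
Sub A P = Σ (A → A) P

-- A change action on U is functional if Ev : U × A → A, Ev(f,a) = f(a),
-- is differentiable w.r.t. the product change action on U × A.
record Functional {a p d e : Level} {A : Set a} {P : (A → A) → Set p}
                  (CA : ChangeAction {a} {d} A)
                  (CU : ChangeAction {a ⊔ p} {e} (Sub A P)) : Set (a ⊔ p ⊔ d ⊔ e) where
  field
    ∂Ev : (Sub A P × A) → (Δ CU × Δ CA) → Δ CA
    ∂Ev-correct : ∀ (f : Sub A P) (x : A) (δf : Δ CU) (δx : Δ CA) →
      proj₁ (_⊕_ CU f δf) (_⊕_ CA x δx) ≡ _⊕_ CA (proj₁ f x) (∂Ev (f , x) (δf , δx))

open Functional public

iterate : ∀ {a} {A : Set a} → (A → A) → ℕ → A → A
iterate f zero    x = x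
iterate f (suc n) x = f (iterate f n x)

iterU : ∀ {a p} {A : Set a} {P : (A → A) → Set p} → A → Sub A P → ℕ → A
iterU ⊥ f n = iterate (proj₁ f) n ⊥

∂₁iterU : ∀ {a p d e} {A : Set a} {P : (A → A) → Set p}
          {CA : ChangeAction {a} {d} A} {CU : ChangeAction {a ⊔ p} {e} (Sub A P)} →
          Functional CA CU → A → Sub A P → ℕ → Δ CU → Δ CA
∂₁iterU {CA = CA} F ⊥ f zero    δf = 0Δ CA
∂₁iterU           F ⊥ f (suc n) δf =
  ∂Ev F (f , iterU ⊥ f n) (δf , ∂₁iterU F ⊥ f n δf)

module Submission where

-- Induction on n: the base case is the identity law of the action, and the step
-- f⊕δf (f^n ⊥ ⊕ ∂₁) = f(f^n ⊥) ⊕ ∂Ev(…) is exactly the derivative condition of Ev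
-- at the point (f , f^n ⊥) with the changes (δf , ∂₁iter f n δf).

open import Defs
open import Level using (Level; _⊔_)
open import Data.Nat using (ℕ; zero; suc)
open import Data.Product using (proj₁)
open import Relation.Binary.PropositionalEquality using (_≡_; sym; cong; module ≡-Reasoning)

mainTheorem19 : ∀ {a p d e : Level} {A : Set a} {P : (A → A) → Set p}
    (CA : ChangeAction {a} {d} A) (⊥ : A)
    (CU : ChangeAction {a ⊔ p} {e} (Sub A P)) (F : Functional CA CU) →
    ∀ (f : Sub A P) (δf : Δ CU) (n : ℕ) →
      iterU ⊥ (_⊕_ CU f δf) n ≡ _⊕_ CA (iterU ⊥ f n) (∂₁iterU F ⊥ f n δf)
mainTheorem19 CA ⊥ CU F f δf zero = sym (⊕-0 CA ⊥)
mainTheorem19 CA ⊥ CU F f δf (suc n) = begin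
  proj₁ (_⊕_ CU f δf) (iterU ⊥ (_⊕_ CU f δf) n)
    ≡⟨ cong (proj₁ (_⊕_ CU f δf)) (mainTheorem19 CA ⊥ CU F f δf n) ⟩
  proj₁ (_⊕_ CU f δf) (_⊕_ CA (iterU ⊥ f n) (∂₁iterU F ⊥ f n δf))
    ≡⟨ ∂Ev-correct F f (iterU ⊥ f n) δf (∂₁iterU F ⊥ f n δf) ⟩
  _⊕_ CA (iterU ⊥ f (suc n)) (∂₁iterU F ⊥ f (suc n) δf)
    ∎
  where open ≡-Reasoning
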